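{- Let $D=(V,A)$ be a digraph and $\mathcal{L}\subseteq 2^V$ a laminar family with $V\in\mathcal{L}$ and $\{v\}\in\mathcal{L}$ for every $v\in V$. Suppose that $f_{D[F],\mathcal{L}[F]}(Z_1)+f_{D[F],\mathcal{L}[F]}(Z_2)\ge 1$ for every $F\in\mathcal{L}$ and every pair of non-empty disjoint sets $Z_1,Z_2\subseteq F$. If $X,Y\subseteq V$ satisfy $f_{D,\mathcal{L}}(X)=f_{D,\mathcal{L}}(Y)=0$, then $f_{D,\mathcal{L}}(X\cap Y)=0$.
   Context: $D[F]$ is the subdigraph induced by $F$, $\mathcal{L}[F]=\{F'\in\mathcal{L}:F'\subseteq F\}$. For a digraph $G$ on node set $U$, a laminar $\mathcal{K}\subseteq 2^U$ and $Z\subseteq U$: $\mathcal{K}_Z=\{F\in\mathcal{K}:F\cap Z\ne\emptyset\}$, $M_{G,\mathcal{K}}(Z)=\delta^{in}_G(Z)\setminus\bigcup_{F\in\mathcal{K}_Z}\delta^{out}_G(F)$ and $f_{G,\mathcal{K}}(Z)=|M_{G,\mathcal{K}}(Z)|$. -}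

module Defs where

open import Data.Nat using (ℕ)
open import Data.Fin using (Fin)
open import Data.Fin.Subset using (Subset; _∈_; _∉_; _⊆_; _∩_; Nonempty; Empty)
open import Data.Fin.Subset.Properties using (_∈?_; _⊆?_; nonempty?)
open import Data.Product using (_×_; _,_)
open import Data.Sum using (_⊎_)
open import Data.List using (List; filter; length)
open import Data.List.Relation.Unary.Any using (any?)
import Data.List.Membership.Propositional as LM
open import Relation.Nullary using (Dec; ¬?)
open import Relation.Nullary.Decidable using (_×-dec_)

_∈ᴸ_ : ∀ {n} → Subset n → List (Subset n) → Set
F ∈ᴸ 𝓛 = F LM.∈ 𝓛

-- A (multi)digraph on node set Fin n: list of arcs (tail , head).
Digraph : ℕ → Set
Digraph n = List (Fin n × Fin n)

Enters : ∀ {n} → Subset n → Fin n × Fin n → Set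
Enters Z (u , v) = u ∉ Z × v ∈ Z

enters? : ∀ {n} (Z : Subset n) (a : Fin n × Fin n) → Dec (Enters Z a)
enters? Z (u , v) = ¬? (u ∈? Z) ×-dec (v ∈? Z)

Leaves : ∀ {n} → Subset n → Fin n × Fin n → Set
Leaves F (u , v) = u ∈ F × v ∉ F

leaves? : ∀ {n} (F : Subset n) (a : Fin n × Fin n) → Dec (Leaves F a)
leaves? F (u , v) = (u ∈? F) ×-dec ¬? (v ∈? F)

M : ∀ {n} → Digraph n → List (Subset n) → Subset n → List (Fin n × Fin n)
M G K Z = filter (λ a → enters? Z a ×-dec
                         ¬? (any? (λ F → nonempty? (F ∩ Z) ×-dec leaves? F a) K)) G

-- f_{G,K}(Z) = |M_{G,K}(Z)|  (arcs counted with multiplicity)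
f : ∀ {n} → Digraph n → List (Subset n) → Subset n → ℕ
f G K Z = length (M G K Z)

-- induced subdigraph D[F]: arcs with both ends in F
-- (nodes outside F are kept as isolated nodes; irrelevant for Z ⊆ F)
induced : ∀ {n} → Digraph n → Subset n → Digraph n
induced D F = filter (λ { (u , v) → (u ∈? F) ×-dec (v ∈? F) }) D

restrict : ∀ {n} → List (Subset n) → Subset n → List (Subset n)
restrict 𝓛 F = filter (_⊆? F) 𝓛

Laminar : ∀ {n} → List (Subset n) → Set
Laminar 𝓛 = ∀ {F G} → F ∈ᴸ 𝓛 → G ∈ᴸ 𝓛 → (F ⊆ G) ⊎ (G ⊆ F) ⊎ Empty (F ∩ G)

-- An arc (u, v) entering X ∩ Y leaves a member of 𝓛 meeting X and a member of 𝓛 meeting Y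
-- (when u lies in X or Y the singleton {u} serves, otherwise the arc enters that set and f = 0
-- supplies one). Both contain u, so by laminarity the larger one, P, meets X and Y. If P missed
-- X ∩ Y, then P ∩ X and P ∩ Y would be disjoint non-empty subsets of P, while f = 0 on X and Y
-- passes down to f_{D[P],𝓛[P]} = 0 on P ∩ X and P ∩ Y, against the hypothesis. So P meets X ∩ Y
-- and the arc is not counted in f(X ∩ Y).
module Submission where

open import Defs
open import Data.Nat using (ℕ; _+_; _≥_)
open import Data.Nat.Properties using (<⇒≢)
open import Data.Fin using (Fin)
open import Data.Fin.Subset using (Subset; ⊤; ⁅_⁆; _⊆_; _∩_; Nonempty; Empty; _∈_)
open import Data.Fin.Subset.Properties
  using (_∈?_; _⊆?_; nonempty?; x∈p∩q⁺; x∈p∩q⁻; p∩q⊆p; x∈⁅x⁆; x∈⁅y⁆⇒x≡y)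
open import Data.List using (List; filter; length)
open import Data.List.Properties using (filter-some; filter-none)
import Data.List.Relation.Unary.All as All
open import Data.List.Relation.Unary.Any using (any?)
import Data.List.Membership.Propositional as LM
open import Data.List.Membership.Propositional.Properties using (∈-filter⁺; ∈-filter⁻)
open import Data.Product using (_×_; _,_; proj₂; ∃-syntax)
open import Data.Sum using (inj₁; inj₂)
open import Relation.Binary.PropositionalEquality using (_≡_; _≢_; refl; sym; cong; cong₂)
open import Relation.Nullary using (¬_; yes; no; _×-dec_; contradiction)
open import Relation.Unary using (Decidable)

module _ {A : Set} {P : A → Set} (P? : Decidable P) where

  length-filter≡0⇒¬ : ∀ {xs x} → length (filter P? xs) ≡ 0 → x LM.∈ xs → ¬ P x
  length-filter≡0⇒¬ eq x∈xs px = <⇒≢ (filter-some P? (LM.lose x∈xs px)) (sym eq)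

  ¬⇒length-filter≡0 : ∀ {xs} → (∀ {x} → x LM.∈ xs → ¬ P x) → length (filter P? xs) ≡ 0
  ¬⇒length-filter≡0 h = cong length (filter-none P? (All.tabulate h))

module _ {n : ℕ} where

  meets-mono : ∀ {F G Z : Subset n} → F ⊆ G → Nonempty (F ∩ Z) → Nonempty (G ∩ Z)
  meets-mono {F} {Z = Z} F⊆G (x , x∈F∩Z) =
    let (x∈F , x∈Z) = x∈p∩q⁻ F Z x∈F∩Z in x , x∈p∩q⁺ (F⊆G x∈F , x∈Z)

  ⊆⇒meets-∩ : ∀ {G F Z : Subset n} → G ⊆ F → Nonempty (G ∩ Z) → Nonempty (G ∩ (F ∩ Z))
  ⊆⇒meets-∩ {G} {Z = Z} G⊆F (x , x∈G∩Z) =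
    let (x∈G , x∈Z) = x∈p∩q⁻ G Z x∈G∩Z in x , x∈p∩q⁺ (x∈G , x∈p∩q⁺ (G⊆F x∈G , x∈Z))

  Shielded : List (Subset n) → Subset n → Fin n × Fin n → Set
  Shielded K Z a = ∃[ F ] F ∈ᴸ K × Nonempty (F ∩ Z) × Leaves F a

  f≡0⇒shielded : ∀ {G K Z a} → f G K Z ≡ 0 → a LM.∈ G → Enters Z a → Shielded K Z a
  f≡0⇒shielded {G} {K} {Z} {a} eq a∈G enters
    with any? (λ F → nonempty? (F ∩ Z) ×-dec leaves? F a) K
  ... | yes shield = LM.find shield
  ... | no ¬shield = contradiction (enters , ¬shield) (length-filter≡0⇒¬ _ eq a∈G)

  shielded⇒f≡0 : ∀ {G K Z} → (∀ {a} → a LM.∈ G → Enters Z a → Shielded K Z a) → f G K Z ≡ 0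
  shielded⇒f≡0 {G} shield = ¬⇒length-filter≡0 _ {xs = G} λ a∈G (enters , ¬shield) →
    let (F , F∈K , meets , leaves) = shield a∈G enters in ¬shield (LM.lose F∈K (meets , leaves))

  ∈-induced⁻ : ∀ {D : Digraph n} {F : Subset n} {u v} →
    (u , v) LM.∈ induced D F → (u , v) LM.∈ D × u ∈ F × v ∈ F
  ∈-induced⁻ {D} {F} a∈D[F] = ∈-filter⁻ (λ { (u , v) → (u ∈? F) ×-dec (v ∈? F) }) {xs = D} a∈D[F]

  f≡0⇒f-restrict≡0 : ∀ {D : Digraph n} {𝓛 F Z} → Laminar 𝓛 → F ∈ᴸ 𝓛 → f D 𝓛 Z ≡ 0 →
    f (induced D F) (restrict 𝓛 F) (F ∩ Z) ≡ 0
  f≡0⇒f-restrict≡0 {D} {𝓛} {F} {Z} laminar F∈𝓛 fZ≡0 = shielded⇒f≡0 shield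
    where
    shield : ∀ {a} → a LM.∈ induced D F → Enters (F ∩ Z) a → Shielded (restrict 𝓛 F) (F ∩ Z) a
    shield {u , v} a∈D[F] (u∉F∩Z , v∈F∩Z) with ∈-induced⁻ {D} {F} a∈D[F]
    ... | a∈D , u∈F , v∈F
      with f≡0⇒shielded fZ≡0 a∈D
             ((λ u∈Z → u∉F∩Z (x∈p∩q⁺ (u∈F , u∈Z))) , proj₂ (x∈p∩q⁻ F Z v∈F∩Z))
    ... | G , G∈𝓛 , G-meets-Z , u∈G , v∉G with laminar G∈𝓛 F∈𝓛
    ... | inj₁ G⊆F = G , ∈-filter⁺ (_⊆? F) G∈𝓛 G⊆F , ⊆⇒meets-∩ G⊆F G-meets-Z , u∈G , v∉G
    ... | inj₂ (inj₁ F⊆G) = contradiction (F⊆G v∈F) v∉G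
    ... | inj₂ (inj₂ G∩F=∅) = contradiction (u , x∈p∩q⁺ (u∈G , u∈F)) G∩F=∅

  f≡0⇒shielded-into : ∀ {D : Digraph n} {𝓛 Z u v} → (∀ w → ⁅ w ⁆ ∈ᴸ 𝓛) → f D 𝓛 Z ≡ 0 →
    (u , v) LM.∈ D → u ≢ v → v ∈ Z → Shielded 𝓛 Z (u , v)
  f≡0⇒shielded-into {Z = Z} {u} singletons fZ≡0 a∈D u≢v v∈Z with u ∈? Z
  ... | yes u∈Z = ⁅ u ⁆ , singletons u , (u , x∈p∩q⁺ (x∈⁅x⁆ u , u∈Z)) , x∈⁅x⁆ u ,
                  λ v∈⁅u⁆ → u≢v (sym (x∈⁅y⁆⇒x≡y u v∈⁅u⁆))
  ... | no u∉Z = f≡0⇒shielded fZ≡0 a∈D (u∉Z , v∈Z)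

  laminar-merge-shields : ∀ {𝓛 X Y a} → Laminar 𝓛 → Shielded 𝓛 X a → Shielded 𝓛 Y a →
    ∃[ P ] P ∈ᴸ 𝓛 × Nonempty (P ∩ X) × Nonempty (P ∩ Y) × Leaves P a
  laminar-merge-shields {a = u , _} laminar (F , F∈𝓛 , F-meets-X , u∈F , v∉F)
                                            (G , G∈𝓛 , G-meets-Y , u∈G , v∉G)
    with laminar F∈𝓛 G∈𝓛
  ... | inj₁ F⊆G = G , G∈𝓛 , meets-mono F⊆G F-meets-X , G-meets-Y , u∈G , v∉G
  ... | inj₂ (inj₁ G⊆F) = F , F∈𝓛 , F-meets-X , meets-mono G⊆F G-meets-Y , u∈F , v∉F
  ... | inj₂ (inj₂ F∩G=∅) = contradiction (u , x∈p∩q⁺ (u∈F , u∈G)) F∩G=∅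

  DisjointPairBound : Digraph n → List (Subset n) → Set
  DisjointPairBound D 𝓛 = ∀ (F Z₁ Z₂ : Subset n) → F ∈ᴸ 𝓛 → Z₁ ⊆ F → Z₂ ⊆ F →
    Nonempty Z₁ → Nonempty Z₂ → Empty (Z₁ ∩ Z₂) →
    f (induced D F) (restrict 𝓛 F) Z₁ + f (induced D F) (restrict 𝓛 F) Z₂ ≥ 1

  meets-∩ : ∀ {D : Digraph n} {𝓛 X Y P} → Laminar 𝓛 → DisjointPairBound D 𝓛 →
    f D 𝓛 X ≡ 0 → f D 𝓛 Y ≡ 0 → P ∈ᴸ 𝓛 →
    Nonempty (P ∩ X) → Nonempty (P ∩ Y) → Nonempty (P ∩ (X ∩ Y))
  meets-∩ {D} {𝓛} {X} {Y} {P} laminar bound fX≡0 fY≡0 P∈𝓛 meets-X meets-Y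
    with nonempty? (P ∩ (X ∩ Y))
  ... | yes meets-X∩Y = meets-X∩Y
  ... | no misses-X∩Y = contradiction
    (bound P (P ∩ X) (P ∩ Y) P∈𝓛 (p∩q⊆p P X) (p∩q⊆p P Y) meets-X meets-Y disjoint)
    (λ sum≥1 → <⇒≢ sum≥1 (sym restricted-f-vanish))
    where
    restricted-f-vanish :
      f (induced D P) (restrict 𝓛 P) (P ∩ X) + f (induced D P) (restrict 𝓛 P) (P ∩ Y) ≡ 0
    restricted-f-vanish = cong₂ _+_ (f≡0⇒f-restrict≡0 {D} laminar P∈𝓛 fX≡0)
                                    (f≡0⇒f-restrict≡0 {D} laminar P∈𝓛 fY≡0)

    disjoint : Empty ((P ∩ X) ∩ (P ∩ Y))
    disjoint (x , x∈) =
      let (x∈P∩X , x∈P∩Y) = x∈p∩q⁻ (P ∩ X) (P ∩ Y) x∈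
          (x∈P , x∈X) = x∈p∩q⁻ P X x∈P∩X
          (_ , x∈Y) = x∈p∩q⁻ P Y x∈P∩Y
      in misses-X∩Y (x , x∈p∩q⁺ (x∈P , x∈p∩q⁺ (x∈X , x∈Y)))

claim9 : ∀ {n : ℕ} (D : Digraph n) (𝓛 : List (Subset n)) →
    Laminar 𝓛 →
    ⊤ ∈ᴸ 𝓛 →
    (∀ (v : Fin n) → ⁅ v ⁆ ∈ᴸ 𝓛) →
    (∀ (F Z₁ Z₂ : Subset n) → F ∈ᴸ 𝓛 → Z₁ ⊆ F → Z₂ ⊆ F →
      Nonempty Z₁ → Nonempty Z₂ → Empty (Z₁ ∩ Z₂) →
      f (induced D F) (restrict 𝓛 F) Z₁ + f (induced D F) (restrict 𝓛 F) Z₂ ≥ 1) →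
    ∀ (X Y : Subset n) → f D 𝓛 X ≡ 0 → f D 𝓛 Y ≡ 0 → f D 𝓛 (X ∩ Y) ≡ 0
claim9 D 𝓛 laminar _ singletons bound X Y fX≡0 fY≡0 = shielded⇒f≡0 shield
  where
  shield : ∀ {a} → a LM.∈ D → Enters (X ∩ Y) a → Shielded 𝓛 (X ∩ Y) a
  shield {u , v} a∈D (u∉X∩Y , v∈X∩Y) =
    let (v∈X , v∈Y) = x∈p∩q⁻ X Y v∈X∩Y
        u≢v : u ≢ v
        u≢v = λ { refl → u∉X∩Y v∈X∩Y }
        (P , P∈𝓛 , meets-X , meets-Y , leaves) = laminar-merge-shields laminar
          (f≡0⇒shielded-into singletons fX≡0 a∈D u≢v v∈X)
          (f≡0⇒shielded-into singletons fY≡0 a∈D u≢v v∈Y)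
    in P , P∈𝓛 , meets-∩ {D = D} laminar bound fX≡0 fY≡0 P∈𝓛 meets-X meets-Y , leaves
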